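{- For every duplicative forest $\mathfrak{f}$, the posets $\mathcal{D}^*(\mathfrak{f})$ and $\mathcal{D}^*(\mathrm{pr}(\mathfrak{f}))$ are isomorphic.
   Context: A duplicative forest is a finite word $\mathfrak{f}_1\cdots\mathfrak{f}_\ell$ of duplicative trees (empty word $\epsilon$ allowed); a duplicative tree is $\circ(\mathfrak{g})$ or $\bullet(\mathfrak{g})$ for a duplicative forest $\mathfrak{g}$ (planar rooted tree with white/black nodes). $\cdot$ is concatenation. $\mathfrak{f}\lessdot\mathfrak{f}'$ iff $\mathfrak{f}'$ is obtained from $\mathfrak{f}$ by replacing one subtree $\circ(\mathfrak{g})$ by $\bullet(\mathfrak{g}\cdot\mathfrak{g})$; $\ll$ is its reflexive transitive closure; $\mathcal{D}^*(\mathfrak{f}) := \{\mathfrak{f}' : \mathfrak{f}\ll\mathfrak{f}'\}$ ordered by $\ll$. The pruning map is defined by $\mathrm{pr}(\mathfrak{f}_1\cdots\mathfrak{f}_\ell) := \mathrm{pr}(\mathfrak{f}_1)\cdots\mathrm{pr}(\mathfrak{f}_\ell)$ for trees $\mathfrak{f}_i$, $\mathrm{pr}(\circ(\mathfrak{f})) := \circ(\mathrm{pr}(\mathfrak{f}))$, and $\mathrm{pr}(\bullet(\mathfrak{f})) := \mathrm{pr}(\mathfrak{f})$ (so $\mathrm{pr}(\epsilon)=\epsilon$). -}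

module Defs where

open import Data.List using (List; []; _∷_; _++_)
open import Data.Product using (Σ; _×_; proj₁)
open import Relation.Binary.PropositionalEquality using (_≡_)
open import Relation.Binary.Construct.Closure.ReflexiveTransitive using (Star)
open import Function using (_⇔_)

mutual
  data Tree : Set where
    white : Forest → Tree
    black : Forest → Tree

  Forest : Set
  Forest = List Tree

-- concatenation of forests is list append _++_ ; ε is [].

mutual
  data _⋖ᵗ_ : Tree → Tree → Set where
    dup   : ∀ g → white g ⋖ᵗ black (g ++ g)
    inW   : ∀ {g g'} → g ⋖ g' → white g ⋖ᵗ white g'
    inB   : ∀ {g g'} → g ⋖ g' → black g ⋖ᵗ black g'

  data _⋖_ : Forest → Forest → Set where
    here  : ∀ {t t'} fs → t ⋖ᵗ t' → (t ∷ fs) ⋖ (t' ∷ fs)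
    there : ∀ {fs fs'} t → fs ⋖ fs' → (t ∷ fs) ⋖ (t ∷ fs')

_≪_ : Forest → Forest → Set
_≪_ = Star _⋖_

D* : Forest → Set
D* f = Σ Forest (λ f' → f ≪ f')

mutual
  prT : Tree → Forest
  prT (white g) = white (pr g) ∷ []
  prT (black g) = pr g

  pr : Forest → Forest
  pr [] = []
  pr (t ∷ ts) = prT t ++ pr ts

record PosetIso (f f' : Forest) : Set where
  field
    to      : D* f → D* f'
    from    : D* f' → D* f
    from∘to : ∀ x → proj₁ (from (to x)) ≡ proj₁ x
    to∘from : ∀ y → proj₁ (to (from y)) ≡ proj₁ y
    to-≪    : ∀ x y → (proj₁ x ≪ proj₁ y) ⇔ (proj₁ (to x) ≪ proj₁ (to y))

{-# OPTIONS --safe #-}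
module Submission where

-- Going up from f, black nodes never change, and a white node white g can only
-- become white g' with g ≪ g', or black (h₁ ++ h₂) with g ≪ h₁ and g ≪ h₂: this is
-- the structural order ≼, which coincides with ≪. A forest x ≽ f is therefore
-- determined by f and what happens below its white nodes, and that is exactly a
-- forest above pr f: deleting from x the nodes that come from black nodes of f,
-- and reinserting them, are mutually inverse monotone maps.

open import Level using (Level)
open import Data.List using (List; []; _∷_; _++_; length; take; drop)
open import Data.List.Relation.Binary.Pointwise
  using (Pointwise; []; _∷_; ++⁺; Pointwise-length)
open import Data.Product using (∃₂; _×_; _,_)
open import Relation.Binary.PropositionalEquality
  using (_≡_; refl; trans; cong; cong₂; subst₂; module ≡-Reasoning)
open import Relation.Binary.Construct.Closure.ReflexiveTransitive
  using (Star; ε; _◅_; _◅◅_; gmap)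
open import Function.Bundles using (mk⇔)

open import Defs

private
  variable
    a ℓ : Level
    A B : Set a

take-length-++ : ∀ {n} (xs : List A) {ys} → n ≡ length xs → take n (xs ++ ys) ≡ xs
take-length-++ []       refl = refl
take-length-++ (x ∷ xs) refl = cong (x ∷_) (take-length-++ xs refl)

drop-length-++ : ∀ {n} (xs : List A) {ys} → n ≡ length xs → drop n (xs ++ ys) ≡ ys
drop-length-++ []       refl = refl
drop-length-++ (x ∷ xs) refl = drop-length-++ xs refl

Pointwise-++⁻ : {R : A → B → Set ℓ} (xs : List A) {ys : List A} {zs : List B} →
  Pointwise R (xs ++ ys) zs →
  ∃₂ λ zs₁ zs₂ → zs ≡ zs₁ ++ zs₂ × Pointwise R xs zs₁ × Pointwise R ys zs₂
Pointwise-++⁻ []       rs       = [] , _ , refl , [] , rs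
Pointwise-++⁻ (x ∷ xs) (r ∷ rs) with Pointwise-++⁻ xs rs
... | zs₁ , zs₂ , refl , rs₁ , rs₂ = _ , zs₂ , refl , r ∷ rs₁ , rs₂

mutual
  data _≼ᵗ_ : Tree → Tree → Set where
    white≼white : ∀ {g g'} → g ≼ g' → white g ≼ᵗ white g'
    white≼black : ∀ {g h₁ h₂ k} → g ≼ h₁ → g ≼ h₂ → k ≡ h₁ ++ h₂ → white g ≼ᵗ black k
    black≼black : ∀ {g g'} → g ≼ g' → black g ≼ᵗ black g'

  _≼_ : Forest → Forest → Set
  _≼_ = Pointwise _≼ᵗ_

mutual
  ≼ᵗ-refl : ∀ t → t ≼ᵗ t
  ≼ᵗ-refl (white g) = white≼white (≼-refl g)
  ≼ᵗ-refl (black g) = black≼black (≼-refl g)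

  ≼-refl : ∀ f → f ≼ f
  ≼-refl []       = []
  ≼-refl (t ∷ ts) = ≼ᵗ-refl t ∷ ≼-refl ts

mutual
  ≼ᵗ-trans : ∀ {s t u} → s ≼ᵗ t → t ≼ᵗ u → s ≼ᵗ u
  ≼ᵗ-trans (white≼white p) (white≼white q) = white≼white (≼-trans p q)
  ≼ᵗ-trans (white≼white p) (white≼black q₁ q₂ e) = white≼black (≼-trans p q₁) (≼-trans p q₂) e
  ≼ᵗ-trans (white≼black {h₁ = h₁} p₁ p₂ refl) (black≼black q) with Pointwise-++⁻ h₁ q
  ... | _ , _ , e , q₁ , q₂ = white≼black (≼-trans p₁ q₁) (≼-trans p₂ q₂) e
  ≼ᵗ-trans (black≼black p) (black≼black q) = black≼black (≼-trans p q)

  ≼-trans : ∀ {f g h} → f ≼ g → g ≼ h → f ≼ h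
  ≼-trans []       []       = []
  ≼-trans (p ∷ ps) (q ∷ qs) = ≼ᵗ-trans p q ∷ ≼-trans ps qs

mutual
  ⋖ᵗ⇒≼ᵗ : ∀ {t t'} → t ⋖ᵗ t' → t ≼ᵗ t'
  ⋖ᵗ⇒≼ᵗ (dup g) = white≼black (≼-refl g) (≼-refl g) refl
  ⋖ᵗ⇒≼ᵗ (inW s) = white≼white (⋖⇒≼ s)
  ⋖ᵗ⇒≼ᵗ (inB s) = black≼black (⋖⇒≼ s)

  ⋖⇒≼ : ∀ {f f'} → f ⋖ f' → f ≼ f'
  ⋖⇒≼ (here fs s)  = ⋖ᵗ⇒≼ᵗ s ∷ ≼-refl fs
  ⋖⇒≼ (there t s) = ≼ᵗ-refl t ∷ ⋖⇒≼ s

≪⇒≼ : ∀ {f f'} → f ≪ f' → f ≼ f'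
≪⇒≼ ε        = ≼-refl _
≪⇒≼ (s ◅ ss) = ≼-trans (⋖⇒≼ s) (≪⇒≼ ss)

⋖-append : ∀ {f f'} g → f ⋖ f' → (f ++ g) ⋖ (f' ++ g)
⋖-append g (here fs s)  = here (fs ++ g) s
⋖-append g (there t s) = there t (⋖-append g s)

⋖-prepend : ∀ f {g g'} → g ⋖ g' → (f ++ g) ⋖ (f ++ g')
⋖-prepend []      s = s
⋖-prepend (t ∷ f) s = there t (⋖-prepend f s)

mutual
  ≼ᵗ⇒⋖ᵗ* : ∀ {t t'} → t ≼ᵗ t' → Star _⋖ᵗ_ t t'
  ≼ᵗ⇒⋖ᵗ* (white≼white p) = gmap white inW (≼⇒≪ p)
  ≼ᵗ⇒⋖ᵗ* (white≼black {g = g} {h₁ = h₁} p₁ p₂ refl) =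
    dup g ◅ gmap black inB (gmap (_++ g) (⋖-append g) (≼⇒≪ p₁) ◅◅ gmap (h₁ ++_) (⋖-prepend h₁) (≼⇒≪ p₂))
  ≼ᵗ⇒⋖ᵗ* (black≼black p) = gmap black inB (≼⇒≪ p)

  ≼⇒≪ : ∀ {f f'} → f ≼ f' → f ≪ f'
  ≼⇒≪ []                          = ε
  ≼⇒≪ (_∷_ {y = t'} {xs = ts} p ps) =
    gmap (_∷ ts) (here ts) (≼ᵗ⇒⋖ᵗ* p) ◅◅ gmap (t' ∷_) (there t') (≼⇒≪ ps)

-- prune f x deletes from x the nodes coming from black nodes of f and graft f y
-- reinserts them; the clauses for non-matching shapes are junk, never reached
-- when f ≼ x, resp. pr f ≼ y.
mutual
  pruneᵗ : Tree → Tree → Forest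
  pruneᵗ (white g) (white g') = white (prune g g') ∷ []
  pruneᵗ (white g) (black h)  = black (prune g (take (length g) h) ++ prune g (drop (length g) h)) ∷ []
  pruneᵗ (black g) (black g') = prune g g'
  pruneᵗ (black g) (white _)  = []

  prune : Forest → Forest → Forest
  prune (t ∷ ts) (u ∷ us) = pruneᵗ t u ++ prune ts us
  prune _        _        = []

mutual
  graftᵗ : Tree → Forest → Tree
  graftᵗ (white g) (white h ∷ _) = white (graft g h)
  graftᵗ (white g) (black k ∷ _) = black (graft g (take (length (pr g)) k) ++ graft g (drop (length (pr g)) k))
  graftᵗ (white g) []            = white g
  graftᵗ (black g) y             = black (graft g y)

  graft : Forest → Forest → Forest
  graft []       _ = []
  graft (t ∷ ts) y = graftᵗ t (take (length (prT t)) y) ∷ graft ts (drop (length (prT t)) y)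

pruneᵗ-white-black : ∀ g {h₁ h₂} → length g ≡ length h₁ →
  pruneᵗ (white g) (black (h₁ ++ h₂)) ≡ black (prune g h₁ ++ prune g h₂) ∷ []
pruneᵗ-white-black g {h₁} {h₂} e rewrite take-length-++ h₁ {h₂} e | drop-length-++ h₁ {h₂} e = refl

graftᵗ-white-black : ∀ g {k₁ k₂} → length (pr g) ≡ length k₁ →
  graftᵗ (white g) (black (k₁ ++ k₂) ∷ []) ≡ black (graft g k₁ ++ graft g k₂)
graftᵗ-white-black g {k₁} {k₂} e rewrite take-length-++ k₁ {k₂} e | drop-length-++ k₁ {k₂} e = refl

graft-∷ : ∀ t ts {y₁ y₂} → length (prT t) ≡ length y₁ →
  graft (t ∷ ts) (y₁ ++ y₂) ≡ graftᵗ t y₁ ∷ graft ts y₂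
graft-∷ t ts {y₁} {y₂} e rewrite take-length-++ y₁ {y₂} e | drop-length-++ y₁ {y₂} e = refl

mutual
  pr≼pruneᵗ : ∀ t {u} → t ≼ᵗ u → prT t ≼ pruneᵗ t u
  pr≼pruneᵗ (white g) (white≼white p) = white≼white (pr≼prune g p) ∷ []
  pr≼pruneᵗ (white g) (white≼black {h₁ = h₁} {h₂} p₁ p₂ refl)
    rewrite pruneᵗ-white-black g {h₁} {h₂} (Pointwise-length p₁) =
    white≼black (pr≼prune g p₁) (pr≼prune g p₂) refl ∷ []
  pr≼pruneᵗ (black g) (black≼black p) = pr≼prune g p

  pr≼prune : ∀ f {x} → f ≼ x → pr f ≼ prune f x
  pr≼prune []       []       = []
  pr≼prune (t ∷ ts) (p ∷ ps) = ++⁺ (pr≼pruneᵗ t p) (pr≼prune ts ps)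

mutual
  ≼graftᵗ : ∀ t {y} → prT t ≼ y → t ≼ᵗ graftᵗ t y
  ≼graftᵗ (white g) (white≼white q ∷ []) = white≼white (≼graft g q)
  ≼graftᵗ (white g) (white≼black {h₁ = k₁} {k₂} q₁ q₂ refl ∷ [])
    rewrite graftᵗ-white-black g {k₁} {k₂} (Pointwise-length q₁) =
    white≼black (≼graft g q₁) (≼graft g q₂) refl
  ≼graftᵗ (black g) q = black≼black (≼graft g q)

  ≼graft : ∀ f {y} → pr f ≼ y → f ≼ graft f y
  ≼graft []       []                  = []
  ≼graft (t ∷ ts) q with Pointwise-++⁻ (prT t) q
  ... | y₁ , y₂ , refl , q₁ , q₂ rewrite graft-∷ t ts {y₁} {y₂} (Pointwise-length q₁) =
    ≼graftᵗ t q₁ ∷ ≼graft ts q₂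

mutual
  graftᵗ-pruneᵗ : ∀ t {u} → t ≼ᵗ u → graftᵗ t (pruneᵗ t u) ≡ u
  graftᵗ-pruneᵗ (white g) (white≼white p) = cong white (graft-prune g p)
  graftᵗ-pruneᵗ (white g) (white≼black {h₁ = h₁} {h₂} p₁ p₂ refl) = begin
    graftᵗ (white g) (pruneᵗ (white g) (black (h₁ ++ h₂)))
      ≡⟨ cong (graftᵗ (white g)) (pruneᵗ-white-black g (Pointwise-length p₁)) ⟩
    graftᵗ (white g) (black (prune g h₁ ++ prune g h₂) ∷ [])
      ≡⟨ graftᵗ-white-black g (Pointwise-length (pr≼prune g p₁)) ⟩
    black (graft g (prune g h₁) ++ graft g (prune g h₂))
      ≡⟨ cong₂ (λ u v → black (u ++ v)) (graft-prune g p₁) (graft-prune g p₂) ⟩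
    black (h₁ ++ h₂) ∎
    where open ≡-Reasoning
  graftᵗ-pruneᵗ (black g) (black≼black p) = cong black (graft-prune g p)

  graft-prune : ∀ f {x} → f ≼ x → graft f (prune f x) ≡ x
  graft-prune []       []       = refl
  graft-prune (t ∷ ts) (p ∷ ps) =
    trans (graft-∷ t ts (Pointwise-length (pr≼pruneᵗ t p))) (cong₂ _∷_ (graftᵗ-pruneᵗ t p) (graft-prune ts ps))

mutual
  pruneᵗ-graftᵗ : ∀ t {y} → prT t ≼ y → pruneᵗ t (graftᵗ t y) ≡ y
  pruneᵗ-graftᵗ (white g) (white≼white q ∷ []) = cong (λ h → white h ∷ []) (prune-graft g q)
  pruneᵗ-graftᵗ (white g) (white≼black {h₁ = k₁} {k₂} q₁ q₂ refl ∷ []) = begin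
    pruneᵗ (white g) (graftᵗ (white g) (black (k₁ ++ k₂) ∷ []))
      ≡⟨ cong (pruneᵗ (white g)) (graftᵗ-white-black g (Pointwise-length q₁)) ⟩
    pruneᵗ (white g) (black (graft g k₁ ++ graft g k₂))
      ≡⟨ pruneᵗ-white-black g (Pointwise-length (≼graft g q₁)) ⟩
    black (prune g (graft g k₁) ++ prune g (graft g k₂)) ∷ []
      ≡⟨ cong₂ (λ u v → black (u ++ v) ∷ []) (prune-graft g q₁) (prune-graft g q₂) ⟩
    black (k₁ ++ k₂) ∷ [] ∎
    where open ≡-Reasoning
  pruneᵗ-graftᵗ (black g) q = prune-graft g q

  prune-graft : ∀ f {y} → pr f ≼ y → prune f (graft f y) ≡ y
  prune-graft []       []                  = refl
  prune-graft (t ∷ ts) q with Pointwise-++⁻ (prT t) q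
  ... | _ , _ , refl , q₁ , q₂ =
    trans (cong (prune (t ∷ ts)) (graft-∷ t ts (Pointwise-length q₁)))
          (cong₂ _++_ (pruneᵗ-graftᵗ t q₁) (prune-graft ts q₂))

mutual
  pruneᵗ-mono : ∀ t {u u'} → t ≼ᵗ u → u ≼ᵗ u' → pruneᵗ t u ≼ pruneᵗ t u'
  pruneᵗ-mono (white g) (white≼white p) (white≼white r) = white≼white (prune-mono g p r) ∷ []
  pruneᵗ-mono (white g) (white≼white p) (white≼black {h₁ = h₁} {h₂} r₁ r₂ refl)
    rewrite pruneᵗ-white-black g {h₁} {h₂} (trans (Pointwise-length p) (Pointwise-length r₁)) =
    white≼black (prune-mono g p r₁) (prune-mono g p r₂) refl ∷ []
  pruneᵗ-mono (white g) (white≼black {h₁ = h₁} {h₂} p₁ p₂ refl) (black≼black r) with Pointwise-++⁻ h₁ r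
  ... | h₁' , h₂' , refl , r₁ , r₂
    rewrite pruneᵗ-white-black g {h₁} {h₂} (Pointwise-length p₁)
          | pruneᵗ-white-black g {h₁'} {h₂'} (trans (Pointwise-length p₁) (Pointwise-length r₁)) =
    black≼black (++⁺ (prune-mono g p₁ r₁) (prune-mono g p₂ r₂)) ∷ []
  pruneᵗ-mono (black g) (black≼black p) (black≼black r) = prune-mono g p r

  prune-mono : ∀ f {x x'} → f ≼ x → x ≼ x' → prune f x ≼ prune f x'
  prune-mono []       []       []       = []
  prune-mono (t ∷ ts) (p ∷ ps) (r ∷ rs) = ++⁺ (pruneᵗ-mono t p r) (prune-mono ts ps rs)

mutual
  graftᵗ-mono : ∀ t {y y'} → prT t ≼ y → y ≼ y' → graftᵗ t y ≼ᵗ graftᵗ t y'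
  graftᵗ-mono (white g) (white≼white q ∷ []) (white≼white r ∷ []) = white≼white (graft-mono g q r)
  graftᵗ-mono (white g) (white≼white q ∷ []) (white≼black {h₁ = k₁} {k₂} r₁ r₂ refl ∷ [])
    rewrite graftᵗ-white-black g {k₁} {k₂} (trans (Pointwise-length q) (Pointwise-length r₁)) =
    white≼black (graft-mono g q r₁) (graft-mono g q r₂) refl
  graftᵗ-mono (white g) (white≼black {h₁ = k₁} {k₂} q₁ q₂ refl ∷ []) (black≼black r ∷ []) with Pointwise-++⁻ k₁ r
  ... | k₁' , k₂' , refl , r₁ , r₂
    rewrite graftᵗ-white-black g {k₁} {k₂} (Pointwise-length q₁)
          | graftᵗ-white-black g {k₁'} {k₂'} (trans (Pointwise-length q₁) (Pointwise-length r₁)) =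
    black≼black (++⁺ (graft-mono g q₁ r₁) (graft-mono g q₂ r₂))
  graftᵗ-mono (black g) q r = black≼black (graft-mono g q r)

  graft-mono : ∀ f {y y'} → pr f ≼ y → y ≼ y' → graft f y ≼ graft f y'
  graft-mono []       []                  []                  = []
  graft-mono (t ∷ ts) q r with Pointwise-++⁻ (prT t) q
  ... | y₁ , y₂ , refl , q₁ , q₂ with Pointwise-++⁻ y₁ r
  ... | y₁' , y₂' , refl , r₁ , r₂
    rewrite graft-∷ t ts {y₁} {y₂} (Pointwise-length q₁)
          | graft-∷ t ts {y₁'} {y₂'} (trans (Pointwise-length q₁) (Pointwise-length r₁)) =
    graftᵗ-mono t q₁ r₁ ∷ graft-mono ts q₂ r₂

lemma2p2p3 : (f : Forest) → PosetIso f (pr f)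
lemma2p2p3 f = record
  { to      = λ (x , p) → prune f x , ≼⇒≪ (pr≼prune f (≪⇒≼ p))
  ; from    = λ (y , q) → graft f y , ≼⇒≪ (≼graft f (≪⇒≼ q))
  ; from∘to = λ (x , p) → graft-prune f (≪⇒≼ p)
  ; to∘from = λ (y , q) → prune-graft f (≪⇒≼ q)
  ; to-≪    = λ (x , p) (x' , p') → mk⇔
      (λ r → ≼⇒≪ (prune-mono f (≪⇒≼ p) (≪⇒≼ r)))
      (λ r → subst₂ _≪_ (graft-prune f (≪⇒≼ p)) (graft-prune f (≪⇒≼ p'))
                         (≼⇒≪ (graft-mono f (pr≼prune f (≪⇒≼ p)) (≪⇒≼ r))))
  }
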